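{- Let $d<\omega$, let $A$ be a Boolean algebra, and let $f\colon A\to[A]^{<\aleph_0}$ be such that for each $n\le d$ and each $\vec x=(x_0,\dots,x_{n-1})\in A^n$ with $\bigwedge_{i<n}x_i=0$ there exists $$\vec y\in\prod_{i<n}\Big(\langle f(x_i)\rangle\cap\Big\langle\bigcup_{j\ne i}f(x_j)\Big\rangle\Big)$$ with $\bigwedge_{i<n}y_i=0$ and $x_i\le y_i$ for all $i<n$. Then $A$ has the $d$-ary FN.
   Context: $[A]^{<\aleph_0}$ is the set of finite subsets of $A$; $\langle S\rangle$ is the subalgebra of $A$ generated by $S$. For subalgebras $B\le A$, $B\le_{\mathrm{rc}}A$ means that for every $y\in A$ the set $\{x\in B:x\le y\}$ has a maximum. A family $\mathcal{C}\subseteq[A]^{<\aleph_1}$ of countable subsets is a club if it is cofinal under inclusion and closed under unions of countable nonempty chains. For $d\le\omega$, $A$ has the $d$-ary FN if there is a club $\mathcal{E}\subseteq[A]^{<\aleph_1}$ such that $B\le_{\mathrm{rc}}A$ for every subalgebra $B$ generated by a union of fewer than $d$ elements of $\mathcal{E}$. -}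

module Defs where

open import Level using (Level; _⊔_; suc)
open import Data.Nat using (ℕ; zero; _≤_; _<_)
import Data.Nat as N
import Data.Fin as F
open import Data.Fin using (Fin)
open import Data.List using (List)
open import Data.List.Relation.Unary.Any using (Any)
open import Data.Product using (Σ; ∃; _×_; _,_)
open import Data.Sum using (_⊎_)
open import Relation.Binary.PropositionalEquality using (_≢_)
open import Relation.Nullary using (¬_)
open import Algebra.Lattice.Bundles using (BooleanAlgebra)

module _ {c ℓ : Level} (A : BooleanAlgebra c ℓ) where
  open BooleanAlgebra A renaming (¬_ to ∁_)

  _≤A_ : Carrier → Carrier → Set ℓ
  x ≤A y = (x ∧ y) ≈ x

  Pred : Set (suc (c ⊔ ℓ))
  Pred = Carrier → Set (c ⊔ ℓ)

  data ⟨_⟩ (S : Pred) : Carrier → Set (c ⊔ ℓ) where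
    gen  : ∀ {x} → S x → ⟨ S ⟩ x
    top  : ⟨ S ⟩ ⊤
    bot  : ⟨ S ⟩ ⊥
    meet : ∀ {x y} → ⟨ S ⟩ x → ⟨ S ⟩ y → ⟨ S ⟩ (x ∧ y)
    join : ∀ {x y} → ⟨ S ⟩ x → ⟨ S ⟩ y → ⟨ S ⟩ (x ∨ y)
    neg  : ∀ {x} → ⟨ S ⟩ x → ⟨ S ⟩ (∁ x)
    resp : ∀ {x y} → x ≈ y → ⟨ S ⟩ x → ⟨ S ⟩ y

  -- the finite subset represented by a list (membership up to ≈)
  ListSet : List Carrier → Pred
  ListSet l z = Any (λ w → w ≈ z) l

  ⋀ : (n : ℕ) → (Fin n → Carrier) → Carrier
  ⋀ zero    x = ⊤
  ⋀ (N.suc n) x = x F.zero ∧ ⋀ n (λ i → x (F.suc i))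

  RelComplete : Pred → Set (c ⊔ ℓ)
  RelComplete B = ∀ y → Σ Carrier λ m → B m × m ≤A y × (∀ x → B x → x ≤A y → x ≤A m)

  -- countable subsets of A: empty, or enumerated (with repetitions) by ℕ
  record CountableSubset : Set (suc (c ⊔ ℓ)) where
    field
      mem       : Pred
      mem-resp  : ∀ {x y} → x ≈ y → mem x → mem y
      countable : (∀ x → ¬ mem x)
                ⊎ Σ (ℕ → Carrier) (λ e → (∀ k → mem (e k)) × (∀ x → mem x → ∃ λ k → e k ≈ x))
  open CountableSubset public

  _⊆_ : CountableSubset → CountableSubset → Set (c ⊔ ℓ)
  S ⊆ T = ∀ x → mem S x → mem T x

  -- a club of countable subsets: cofinal and closed under unions of countable nonempty chains
  -- (a countable nonempty chain is enumerated, with repetitions, by ℕ)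
  IsClub : (CountableSubset → Set (c ⊔ ℓ)) → Set (suc (c ⊔ ℓ))
  IsClub 𝓒 =
      (∀ S → Σ CountableSubset λ T → 𝓒 T × S ⊆ T)
    × (∀ (ch : ℕ → CountableSubset) → (∀ k → 𝓒 (ch k))
         → (∀ k l → ch k ⊆ ch l ⊎ ch l ⊆ ch k)
         → ∀ (U : CountableSubset) → (∀ x → mem U x → ∃ λ k → mem (ch k) x)
         → (∀ k x → mem (ch k) x → mem U x)
         → 𝓒 U)

  HasFN : ℕ → Set (suc (c ⊔ ℓ))
  HasFN d = Σ (CountableSubset → Set (c ⊔ ℓ)) λ 𝓔 → IsClub 𝓔 ×
    (∀ (n : ℕ) → n < d → (E : Fin n → CountableSubset) → (∀ i → 𝓔 (E i))
       → RelComplete ⟨ (λ x → ∃ λ i → mem (E i) x) ⟩)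

  Hyp : ℕ → (Carrier → List Carrier) → Set (c ⊔ ℓ)
  Hyp d f = ∀ (n : ℕ) → n ≤ d → (x : Fin n → Carrier) → ⋀ n x ≈ ⊥ →
    Σ (Fin n → Carrier) λ y →
        (∀ i → ⟨ ListSet (f (x i)) ⟩ (y i)
             × ⟨ (λ z → ∃ λ j → j ≢ i × ListSet (f (x j)) z) ⟩ (y i))
      × ⋀ n y ≈ ⊥
      × (∀ i → x i ≤A y i)

-- The club is the family of countable subalgebras closed under f (with
-- respect to an enumeration). Let B be generated by n < d members
-- T₀, …, Tₙ₋₁ of the club. Every element of B is a finite join of meets
-- t₀ ∧ ⋯ ∧ tₙ₋₁ with tᵢ ∈ Tᵢ. Given y, and such a meet below y, the
-- hypothesis applied to (∁ y, t₀, …, tₙ₋₁) yields z with ∁ y ≤ z₀, tᵢ ≤ zᵢ₊₁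
-- and ⋀ z = 0, and z₀ lies both in ⟨ f (∁ y) ⟩ and (as Tᵢ is closed under f)
-- in B; so ∁ z₀ ∈ ⟨ f (∁ y) ⟩ ∩ B lies between the meet and y. As
-- ⟨ f (∁ y) ⟩ is finite, the join of those of its elements that lie in B
-- below y (selected by excluded middle) is the maximum of B below y.

module Submission where

open import Defs
open import Level using (Level; Lift; lift; lower)
open import Data.Nat as ℕ using (ℕ; zero; suc; _+_; _⊔_; _≤′_; ≤′-refl; ≤′-step)
open import Data.Nat.Properties using (+-identityʳ; +-suc; m≤m⊔n; m≤n⊔m; ≤⇒≤′)
open import Data.Fin as Fin using (Fin; _≟_)
open import Data.Fin.Properties using (suc-injective)
open import Data.Product using (Σ; ∃; ∃₂; _×_; _,_; proj₁; proj₂; uncurry)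
open import Data.Sum using (_⊎_; inj₁; inj₂)
open import Data.Empty using (⊥-elim)
open import Data.List using (List; []; _∷_; map; foldr; cartesianProductWith)
open import Data.List.Relation.Unary.Any as Any using (Any; here; there)
open import Data.Vec.Functional using (updateAt)
open import Data.Vec.Functional.Properties using (updateAt-updates; updateAt-minimal)
open import Function using (const; _∘_)
open import Relation.Binary.PropositionalEquality as ≡ using (_≡_; _≢_)
open import Relation.Nullary using (yes; no)
open import Relation.Binary.Lattice using (Lattice)
open import Algebra.Bundles using (IdempotentCommutativeMonoid)
open import Algebra.Lattice.Bundles using (BooleanAlgebra)
open import Axiom.ExcludedMiddle using (ExcludedMiddle)
import Relation.Binary.Lattice.Properties.MeetSemilattice as MeetSemilatticeProperties
import Algebra.Properties.IdempotentCommutativeMonoid as IdempotentCommutativeMonoidProperties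
import Algebra.Properties.CommutativeSemigroup as CommutativeSemigroupProperties
import Algebra.Lattice.Properties.BooleanAlgebra as BooleanAlgebraProperties
import Data.List.Membership.Setoid as SetoidMembership
import Data.List.Membership.Setoid.Properties as SetoidMembershipProperties
import Relation.Binary.Reasoning.Setoid as SetoidReasoning

next : ℕ × ℕ → ℕ × ℕ
next (a , zero)  = zero , suc a
next (a , suc b) = suc a , b

unpair : ℕ → ℕ × ℕ
unpair zero    = zero , zero
unpair (suc n) = next (unpair n)

unpair-onto-diagonal : ∀ s a b → a + b ≡ s → ∃ λ n → unpair n ≡ (a , b)
unpair-onto-diagonal zero    zero    zero ≡.refl = zero , ≡.refl
unpair-onto-diagonal (suc s) zero    b    ≡.refl =
  let n , eq = unpair-onto-diagonal s s zero (+-identityʳ s) in suc n , ≡.cong next eq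
unpair-onto-diagonal (suc s) (suc a) b    eq     =
  let n , eq′ = unpair-onto-diagonal (suc s) a (suc b) (≡.trans (+-suc a b) eq)
  in  suc n , ≡.cong next eq′

unpair-onto : ∀ a b → ∃ λ n → unpair n ≡ (a , b)
unpair-onto a b = unpair-onto-diagonal (a + b) a b ≡.refl

nthOr : ∀ {a} {X : Set a} → X → List X → ℕ → X
nthOr d []       _       = d
nthOr d (x ∷ xs) zero    = x
nthOr d (x ∷ xs) (suc b) = nthOr d xs b

nthOr-complete : ∀ {a p} {X : Set a} {P : X → Set p} (d : X) {xs} →
                 Any P xs → ∃ λ b → P (nthOr d xs b)
nthOr-complete d (here px)   = zero , px
nthOr-complete d (there pxs) = let b , pb = nthOr-complete d pxs in suc b , pb

module _ {c ℓ : Level} (A : BooleanAlgebra c ℓ) where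

  open BooleanAlgebra A renaming (¬_ to ∁_)
  open BooleanAlgebraProperties A
  -- The library's order x ≤ y is x ≈ x ∧ y, the mirror image of _≤A_.
  open Lattice ∨-∧-orderTheoreticLattice
    using (_≤_; x≤x∨y; y≤x∨y; ∨-least)
    renaming (trans to ≤-trans; ≤-respˡ-≈ to ≤-respˡ; ≤-respʳ-≈ to ≤-respʳ)
  open MeetSemilatticeProperties (Lattice.meetSemilattice ∨-∧-orderTheoreticLattice)
    using (∧-monotonic)
  open SetoidMembership setoid using (_∈_)
  open SetoidMembershipProperties using (∈-resp-≈; ∈-cartesianProductWith⁺; ∈-cartesianProductWith⁻)
  open SetoidReasoning setoid

  ∧-idempotentCommutativeMonoid : IdempotentCommutativeMonoid c ℓ
  ∧-idempotentCommutativeMonoid = record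
    { isIdempotentCommutativeMonoid = record
      { isCommutativeMonoid = ∧-⊤-isCommutativeMonoid ; idem = ∧-idem } }

  open IdempotentCommutativeMonoidProperties ∧-idempotentCommutativeMonoid
    using () renaming (∙-distrˡ-∙ to ∧-distribˡ-∧)
  open CommutativeSemigroupProperties
    (IdempotentCommutativeMonoid.commutativeSemigroup ∧-idempotentCommutativeMonoid)
    using () renaming (interchange to ∧-interchange)

  ≤A⇒≤ : ∀ {x y} → _≤A_ A x y → x ≤ y
  ≤A⇒≤ = sym

  ≤⇒≤A : ∀ {x y} → x ≤ y → _≤A_ A x y
  ≤⇒≤A = sym

  ⊥≤ : ∀ {x} → ⊥ ≤ x
  ⊥≤ {x} = sym (∧-zeroˡ x)

  disjoint⇒≤∁ : ∀ {x z} → x ∧ z ≈ ⊥ → x ≤ ∁ z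
  disjoint⇒≤∁ {x} {z} x∧z≈⊥ = sym (begin
    x ∧ ∁ z             ≈⟨ ∨-identityʳ _ ⟨
    (x ∧ ∁ z) ∨ ⊥       ≈⟨ ∨-congˡ x∧z≈⊥ ⟨
    (x ∧ ∁ z) ∨ (x ∧ z) ≈⟨ ∧-distribˡ-∨ x (∁ z) z ⟨
    x ∧ (∁ z ∨ z)       ≈⟨ ∧-congˡ (∨-complementˡ z) ⟩
    x ∧ ⊤               ≈⟨ ∧-identityʳ x ⟩
    x                   ∎)

  ≤⇒disjoint-∁ : ∀ {x y} → x ≤ y → x ∧ ∁ y ≈ ⊥
  ≤⇒disjoint-∁ {x} {y} x≤y = begin
    x ∧ ∁ y       ≈⟨ ∧-congʳ x≤y ⟩
    (x ∧ y) ∧ ∁ y ≈⟨ ∧-assoc x y (∁ y) ⟩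
    x ∧ (y ∧ ∁ y) ≈⟨ ∧-congˡ (∧-complementʳ y) ⟩
    x ∧ ⊥         ≈⟨ ∧-zeroʳ x ⟩
    ⊥             ∎

  ∁-antitone : ∀ {x y} → x ≤ y → ∁ y ≤ ∁ x
  ∁-antitone {x} {y} x≤y = disjoint⇒≤∁ (trans (∧-comm (∁ y) x) (≤⇒disjoint-∁ x≤y))

  ∁≤⇒∁≤ : ∀ {x z} → ∁ x ≤ z → ∁ z ≤ x
  ∁≤⇒∁≤ {x} ∁x≤z = ≤-respʳ (¬-involutive x) (∁-antitone ∁x≤z)

  ⋀-cong : ∀ n {x y : Fin n → Carrier} → (∀ i → x i ≈ y i) → ⋀ A n x ≈ ⋀ A n y
  ⋀-cong zero    x≈y = refl
  ⋀-cong (suc n) x≈y = ∧-cong (x≈y Fin.zero) (⋀-cong n (x≈y ∘ Fin.suc))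

  ⋀-monotonic : ∀ n {x y : Fin n → Carrier} → (∀ i → x i ≤ y i) → ⋀ A n x ≤ ⋀ A n y
  ⋀-monotonic zero    x≤y = sym (∧-idem ⊤)
  ⋀-monotonic (suc n) x≤y = ∧-monotonic (x≤y Fin.zero) (⋀-monotonic n (x≤y ∘ Fin.suc))

  ⋀-∧ : ∀ n (x y : Fin n → Carrier) → ⋀ A n (λ i → x i ∧ y i) ≈ ⋀ A n x ∧ ⋀ A n y
  ⋀-∧ zero    x y = sym (∧-idem ⊤)
  ⋀-∧ (suc n) x y = trans (∧-congˡ (⋀-∧ n _ _)) (∧-interchange _ _ _ _)

  ⋀-⊤ : ∀ n {x : Fin n → Carrier} → (∀ i → x i ≈ ⊤) → ⋀ A n x ≈ ⊤
  ⋀-⊤ zero    x≈⊤ = refl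
  ⋀-⊤ (suc n) x≈⊤ = trans (∧-cong (x≈⊤ Fin.zero) (⋀-⊤ n (x≈⊤ ∘ Fin.suc))) (∧-idem ⊤)

  ⋀-single : ∀ n {x : Fin n → Carrier} i → (∀ j → j ≢ i → x j ≈ ⊤) → ⋀ A n x ≈ x i
  ⋀-single (suc n) Fin.zero    x≈⊤ =
    trans (∧-congˡ (⋀-⊤ n λ j → x≈⊤ (Fin.suc j) λ ())) (∧-identityʳ _)
  ⋀-single (suc n) (Fin.suc i) x≈⊤ =
    trans (∧-congʳ (x≈⊤ Fin.zero λ ()))
      (trans (∧-identityˡ _) (⋀-single n i λ j j≢i → x≈⊤ (Fin.suc j) (j≢i ∘ suc-injective)))

  ⋁ : List Carrier → Carrier
  ⋁ = foldr _∨_ ⊥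

  ⋁-map-closed : ∀ {p} (P : Carrier → Set p) → P ⊥ → (∀ {x y} → P x → P y → P (x ∨ y)) →
                 ∀ (h : Carrier → Carrier) xs → (∀ z → P (h z)) → P (⋁ (map h xs))
  ⋁-map-closed P P⊥ P∨ h []       Ph = P⊥
  ⋁-map-closed P P⊥ P∨ h (x ∷ xs) Ph = P∨ (Ph x) (⋁-map-closed P P⊥ P∨ h xs Ph)

  ⋁-map-upper : ∀ (h : Carrier → Carrier) {w} xs → Any (λ z → w ≤ h z) xs → w ≤ ⋁ (map h xs)
  ⋁-map-upper h (x ∷ xs) (here w≤hx)  = ≤-trans w≤hx (x≤x∨y _ _)
  ⋁-map-upper h (x ∷ xs) (there w≤hz) = ≤-trans (⋁-map-upper h xs w≤hz) (y≤x∨y _ _)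

  record IsSubalgebra (S : Pred A) : Set (c Level.⊔ ℓ) where
    field
      ⊤-closed : S ⊤
      ∧-closed : ∀ {x y} → S x → S y → S (x ∧ y)
      ∁-closed : ∀ {x} → S x → S (∁ x)

  ⋃ : ∀ {n} → (Fin n → Pred A) → Pred A
  ⋃ E x = ∃ λ i → E i x

  ⟨⟩-monotone : ∀ {S S′ : Pred A} → (∀ {z} → S z → S′ z) → ∀ {x} → ⟨_⟩ A S x → ⟨_⟩ A S′ x
  ⟨⟩-monotone S⊆S′ (gen s)    = gen (S⊆S′ s)
  ⟨⟩-monotone S⊆S′ top        = top
  ⟨⟩-monotone S⊆S′ bot        = bot
  ⟨⟩-monotone S⊆S′ (meet p q) = meet (⟨⟩-monotone S⊆S′ p) (⟨⟩-monotone S⊆S′ q)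
  ⟨⟩-monotone S⊆S′ (join p q) = join (⟨⟩-monotone S⊆S′ p) (⟨⟩-monotone S⊆S′ q)
  ⟨⟩-monotone S⊆S′ (neg p)    = neg (⟨⟩-monotone S⊆S′ p)
  ⟨⟩-monotone S⊆S′ (resp e p) = resp e (⟨⟩-monotone S⊆S′ p)

  -- The subalgebra generated by a finite list is finite

  shannon : Carrier → Carrier → Carrier → Carrier
  shannon a u v = (a ∧ u) ∨ (∁ a ∧ v)

  shannon-cong : ∀ a {u u′ v v′} → u ≈ u′ → v ≈ v′ → shannon a u v ≈ shannon a u′ v′
  shannon-cong a u≈u′ v≈v′ = ∨-cong (∧-congˡ u≈u′) (∧-congˡ v≈v′)

  ≈-by-cases : ∀ a {z w} → a ∧ z ≈ a ∧ w → ∁ a ∧ z ≈ ∁ a ∧ w → z ≈ w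
  ≈-by-cases a {z} {w} a∧z≈a∧w ∁a∧z≈∁a∧w = begin
    z                   ≈⟨ ∧-identityˡ z ⟨
    ⊤ ∧ z               ≈⟨ ∧-congʳ (∨-complementʳ a) ⟨
    (a ∨ ∁ a) ∧ z       ≈⟨ ∧-distribʳ-∨ z a (∁ a) ⟩
    (a ∧ z) ∨ (∁ a ∧ z) ≈⟨ ∨-cong a∧z≈a∧w ∁a∧z≈∁a∧w ⟩
    (a ∧ w) ∨ (∁ a ∧ w) ≈⟨ ∧-distribʳ-∨ w a (∁ a) ⟨
    (a ∨ ∁ a) ∧ w       ≈⟨ ∧-congʳ (∨-complementʳ a) ⟩
    ⊤ ∧ w               ≈⟨ ∧-identityˡ w ⟩
    w                   ∎

  restrict-disjoint : ∀ {p q} u v → p ∧ q ≈ ⊥ → p ∧ ((q ∧ u) ∨ (p ∧ v)) ≈ p ∧ v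
  restrict-disjoint {p} {q} u v p∧q≈⊥ = begin
    p ∧ ((q ∧ u) ∨ (p ∧ v))       ≈⟨ ∧-distribˡ-∨ p (q ∧ u) (p ∧ v) ⟩
    (p ∧ (q ∧ u)) ∨ (p ∧ (p ∧ v)) ≈⟨ ∨-cong (∧-assoc p q u) (∧-assoc p p v) ⟨
    ((p ∧ q) ∧ u) ∨ ((p ∧ p) ∧ v) ≈⟨ ∨-cong (∧-congʳ p∧q≈⊥) (∧-congʳ (∧-idem p)) ⟩
    (⊥ ∧ u) ∨ (p ∧ v)             ≈⟨ ∨-congʳ (∧-zeroˡ u) ⟩
    ⊥ ∨ (p ∧ v)                   ≈⟨ ∨-identityˡ _ ⟩
    p ∧ v                         ∎

  ∧-shannon : ∀ a u v → a ∧ shannon a u v ≈ a ∧ u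
  ∧-shannon a u v = trans (∧-congˡ (∨-comm _ _)) (restrict-disjoint v u (∧-complementʳ a))

  ∁∧-shannon : ∀ a u v → ∁ a ∧ shannon a u v ≈ ∁ a ∧ v
  ∁∧-shannon a u v = restrict-disjoint u v (∧-complementˡ a)

  restrict-∧ : ∀ p {x y u v} → p ∧ x ≈ p ∧ u → p ∧ y ≈ p ∧ v → p ∧ (x ∧ y) ≈ p ∧ (u ∧ v)
  restrict-∧ p {x} {y} {u} {v} p∧x≈p∧u p∧y≈p∧v = begin
    p ∧ (x ∧ y)       ≈⟨ ∧-distribˡ-∧ p x y ⟩
    (p ∧ x) ∧ (p ∧ y) ≈⟨ ∧-cong p∧x≈p∧u p∧y≈p∧v ⟩
    (p ∧ u) ∧ (p ∧ v) ≈⟨ ∧-distribˡ-∧ p u v ⟨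
    p ∧ (u ∧ v)       ∎

  ∧-∁-∧ : ∀ p z → p ∧ ∁ (p ∧ z) ≈ p ∧ ∁ z
  ∧-∁-∧ p z = begin
    p ∧ ∁ (p ∧ z)         ≈⟨ ∧-congˡ (deMorgan₁ p z) ⟩
    p ∧ (∁ p ∨ ∁ z)       ≈⟨ ∧-distribˡ-∨ p (∁ p) (∁ z) ⟩
    (p ∧ ∁ p) ∨ (p ∧ ∁ z) ≈⟨ ∨-congʳ (∧-complementʳ p) ⟩
    ⊥ ∨ (p ∧ ∁ z)         ≈⟨ ∨-identityˡ _ ⟩
    p ∧ ∁ z               ∎

  restrict-∁ : ∀ p {x u} → p ∧ x ≈ p ∧ u → p ∧ ∁ x ≈ p ∧ ∁ u
  restrict-∁ p {x} {u} p∧x≈p∧u =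
    trans (sym (∧-∁-∧ p x)) (trans (∧-congˡ (¬-cong p∧x≈p∧u)) (∧-∁-∧ p u))

  shannon-∧ : ∀ a u v u′ v′ → shannon a u v ∧ shannon a u′ v′ ≈ shannon a (u ∧ u′) (v ∧ v′)
  shannon-∧ a u v u′ v′ = ≈-by-cases a
    (trans (restrict-∧ a (∧-shannon a u v) (∧-shannon a u′ v′)) (sym (∧-shannon a _ _)))
    (trans (restrict-∧ (∁ a) (∁∧-shannon a u v) (∁∧-shannon a u′ v′)) (sym (∁∧-shannon a _ _)))

  shannon-∁ : ∀ a u v → ∁ shannon a u v ≈ shannon a (∁ u) (∁ v)
  shannon-∁ a u v = ≈-by-cases a
    (trans (restrict-∁ a (∧-shannon a u v)) (sym (∧-shannon a _ _)))
    (trans (restrict-∁ (∁ a) (∁∧-shannon a u v)) (sym (∁∧-shannon a _ _)))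

  shannon-idem : ∀ a u → shannon a u u ≈ u
  shannon-idem a u = ≈-by-cases a (∧-shannon a u u) (∁∧-shannon a u u)

  shannon-⊤-⊥ : ∀ a → shannon a ⊤ ⊥ ≈ a
  shannon-⊤-⊥ a = ≈-by-cases a
    (trans (∧-shannon a ⊤ ⊥) (trans (∧-identityʳ a) (sym (∧-idem a))))
    (trans (∁∧-shannon a ⊤ ⊥) (trans (∧-zeroʳ (∁ a)) (sym (∧-complementˡ a))))

  -- Every element of ⟨ a ∷ L ⟩ is shannon a u v for some u, v ∈ ⟨ L ⟩.
  elements : List Carrier → List Carrier
  elements []      = ⊤ ∷ ⊥ ∷ []
  elements (a ∷ L) = cartesianProductWith (shannon a) (elements L) (elements L)

  shannon-∈ : ∀ {a} L {u v x} → u ∈ elements L → v ∈ elements L → shannon a u v ≈ x →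
              x ∈ elements (a ∷ L)
  shannon-∈ {a} L u∈ v∈ eq =
    ∈-resp-≈ setoid eq (∈-cartesianProductWith⁺ setoid setoid setoid (shannon-cong a) u∈ v∈)

  ⊤∈elements : ∀ L → ⊤ ∈ elements L
  ⊤∈elements []      = here refl
  ⊤∈elements (a ∷ L) = shannon-∈ L (⊤∈elements L) (⊤∈elements L) (shannon-idem a ⊤)

  ⊥∈elements : ∀ L → ⊥ ∈ elements L
  ⊥∈elements []      = there (here refl)
  ⊥∈elements (a ∷ L) = shannon-∈ L (⊥∈elements L) (⊥∈elements L) (shannon-idem a ⊥)

  ∧-∈elements : ∀ L {x y} → x ∈ elements L → y ∈ elements L → x ∧ y ∈ elements L
  ∧-∈elements []      (here x≈⊤)         y∈ =
    ∈-resp-≈ setoid (trans (sym (∧-identityˡ _)) (∧-congʳ (sym x≈⊤))) y∈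
  ∧-∈elements []      (there (here x≈⊥)) y∈ =
    ∈-resp-≈ setoid (trans (sym (∧-zeroˡ _)) (∧-congʳ (sym x≈⊥))) (⊥∈elements [])
  ∧-∈elements (a ∷ L) x∈ y∈ =
    let u  , v  , u∈  , v∈  , x≈ = ∈-cartesianProductWith⁻ setoid setoid setoid (shannon a) _ _ x∈
        u′ , v′ , u′∈ , v′∈ , y≈ = ∈-cartesianProductWith⁻ setoid setoid setoid (shannon a) _ _ y∈
    in  shannon-∈ L (∧-∈elements L u∈ u′∈) (∧-∈elements L v∈ v′∈)
          (trans (sym (shannon-∧ a u v u′ v′)) (sym (∧-cong x≈ y≈)))

  ∁-∈elements : ∀ L {x} → x ∈ elements L → ∁ x ∈ elements L
  ∁-∈elements []      (here x≈⊤)         =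
    ∈-resp-≈ setoid (trans (sym ¬⊤≈⊥) (¬-cong (sym x≈⊤))) (⊥∈elements [])
  ∁-∈elements []      (there (here x≈⊥)) =
    ∈-resp-≈ setoid (trans (sym ¬⊥≈⊤) (¬-cong (sym x≈⊥))) (⊤∈elements [])
  ∁-∈elements (a ∷ L) x∈ =
    let u , v , u∈ , v∈ , x≈ = ∈-cartesianProductWith⁻ setoid setoid setoid (shannon a) _ _ x∈
    in  shannon-∈ L (∁-∈elements L u∈) (∁-∈elements L v∈)
          (trans (sym (shannon-∁ a u v)) (sym (¬-cong x≈)))

  ∨-∈elements : ∀ L {x y} → x ∈ elements L → y ∈ elements L → x ∨ y ∈ elements L
  ∨-∈elements L {x} {y} x∈ y∈ =
    ∈-resp-≈ setoid
      (trans (deMorgan₁ (∁ x) (∁ y)) (∨-cong (¬-involutive x) (¬-involutive y)))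
      (∁-∈elements L (∧-∈elements L (∁-∈elements L x∈) (∁-∈elements L y∈)))

  generator-∈elements : ∀ L {x} → ListSet A L x → x ∈ elements L
  generator-∈elements (a ∷ L) (here a≈x)  =
    shannon-∈ L (⊤∈elements L) (⊥∈elements L) (trans (shannon-⊤-⊥ a) a≈x)
  generator-∈elements (a ∷ L) {x} (there x∈L) =
    shannon-∈ L (generator-∈elements L x∈L) (generator-∈elements L x∈L) (shannon-idem a x)

  ⟨⟩⊆elements : ∀ L {x} → ⟨_⟩ A (ListSet A L) x → x ∈ elements L
  ⟨⟩⊆elements L (gen x∈L)  = generator-∈elements L x∈L
  ⟨⟩⊆elements L top        = ⊤∈elements L
  ⟨⟩⊆elements L bot        = ⊥∈elements L
  ⟨⟩⊆elements L (meet p q) = ∧-∈elements L (⟨⟩⊆elements L p) (⟨⟩⊆elements L q)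
  ⟨⟩⊆elements L (join p q) = ∨-∈elements L (⟨⟩⊆elements L p) (⟨⟩⊆elements L q)
  ⟨⟩⊆elements L (neg p)    = ∁-∈elements L (⟨⟩⊆elements L p)
  ⟨⟩⊆elements L (resp e p) = ∈-resp-≈ setoid e (⟨⟩⊆elements L p)

  -- Normal form in the subalgebra generated by finitely many subalgebras

  module _ {n : ℕ} (E : Fin n → Pred A) where

    data JoinOfMeets : Pred A where
      meets  : (t : Fin n → Carrier) → (∀ i → E i (t i)) → JoinOfMeets (⋀ A n t)
      ⊥-join : JoinOfMeets ⊥
      ∨-join : ∀ {x y} → JoinOfMeets x → JoinOfMeets y → JoinOfMeets (x ∨ y)
      ≈-join : ∀ {x y} → x ≈ y → JoinOfMeets x → JoinOfMeets y

    module _ (E-sub : ∀ i → IsSubalgebra (E i)) where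
      open module Sub {i} = IsSubalgebra (E-sub i)

      meets-∧ : ∀ t → (∀ i → E i (t i)) → ∀ {y} → JoinOfMeets y → JoinOfMeets (⋀ A n t ∧ y)
      meets-∧ t t∈E (meets s s∈E) =
        ≈-join (⋀-∧ n t s) (meets (λ i → t i ∧ s i) (λ i → ∧-closed (t∈E i) (s∈E i)))
      meets-∧ t t∈E ⊥-join       = ≈-join (sym (∧-zeroʳ _)) ⊥-join
      meets-∧ t t∈E (∨-join p q) =
        ≈-join (sym (∧-distribˡ-∨ _ _ _)) (∨-join (meets-∧ t t∈E p) (meets-∧ t t∈E q))
      meets-∧ t t∈E (≈-join e p) = ≈-join (∧-congˡ e) (meets-∧ t t∈E p)

      JoinOfMeets-∧ : ∀ {x y} → JoinOfMeets x → JoinOfMeets y → JoinOfMeets (x ∧ y)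
      JoinOfMeets-∧ (meets t t∈E) q = meets-∧ t t∈E q
      JoinOfMeets-∧ ⊥-join        q = ≈-join (sym (∧-zeroˡ _)) ⊥-join
      JoinOfMeets-∧ (∨-join p p′) q =
        ≈-join (sym (∧-distribʳ-∨ _ _ _)) (∨-join (JoinOfMeets-∧ p q) (JoinOfMeets-∧ p′ q))
      JoinOfMeets-∧ (≈-join e p)  q = ≈-join (∧-congʳ e) (JoinOfMeets-∧ p q)

      JoinOfMeets-⊤ : JoinOfMeets ⊤
      JoinOfMeets-⊤ = ≈-join (⋀-⊤ n λ _ → refl) (meets (const ⊤) λ _ → ⊤-closed)

      JoinOfMeets-generator : ∀ {i x} → E i x → JoinOfMeets x
      JoinOfMeets-generator {i} {x} x∈E =
        ≈-join (trans (⋀-single n i (λ j j≢i → reflexive (updateAt-minimal j i (const ⊤) j≢i)))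
                      (reflexive (updateAt-updates i (const ⊤))))
               (meets (updateAt (const ⊤) i (const x)) point∈E)
        where
        point∈E : ∀ j → E j (updateAt (const ⊤) i (const x) j)
        point∈E j with j ≟ i
        ... | yes ≡.refl = ≡.subst (E j) (≡.sym (updateAt-updates j (const ⊤))) x∈E
        ... | no j≢i     = ≡.subst (E j) (≡.sym (updateAt-minimal j i (const ⊤) j≢i)) ⊤-closed

      normalForm : ∀ {x} → ⟨_⟩ A (⋃ E) x → JoinOfMeets x × JoinOfMeets (∁ x)
      normalForm (gen (i , x∈E)) =
        JoinOfMeets-generator x∈E , JoinOfMeets-generator (∁-closed x∈E)
      normalForm top = JoinOfMeets-⊤ , ≈-join (sym ¬⊤≈⊥) ⊥-join
      normalForm bot = ⊥-join , ≈-join (sym ¬⊥≈⊤) JoinOfMeets-⊤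
      normalForm (meet {x} {y} p q) =
        let px , p∁x = normalForm p ; qy , q∁y = normalForm q
        in  JoinOfMeets-∧ px qy , ≈-join (sym (deMorgan₁ x y)) (∨-join p∁x q∁y)
      normalForm (join {x} {y} p q) =
        let px , p∁x = normalForm p ; qy , q∁y = normalForm q
        in  ∨-join px qy , ≈-join (sym (deMorgan₂ x y)) (JoinOfMeets-∧ p∁x q∁y)
      normalForm (neg {x} p) =
        let px , p∁x = normalForm p in p∁x , ≈-join (sym (¬-involutive x)) px
      normalForm (resp e p) =
        let px , p∁x = normalForm p in ≈-join e px , ≈-join (¬-cong e) p∁x

  -- The club of countable subalgebras closed under f

  module _ (f : Carrier → List Carrier) where

    -- f need not respect ≈, so closure under f is only asked of the
    -- elements of a fixed enumeration.
    record IsClosedEnumeration (T : CountableSubset A) (e : ℕ → Carrier) : Set (c Level.⊔ ℓ) where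
      field
        onto  : ∀ {x} → mem T x → ∃ λ k → e k ≈ x
        into  : ∀ k → mem T (e k)
        ⊤-mem : mem T ⊤
        ∧-mem : ∀ a b → mem T (e a ∧ e b)
        ∁-mem : ∀ a → mem T (∁ e a)
        f-mem : ∀ a {z} → ListSet A (f (e a)) z → mem T z

    FClosed : CountableSubset A → Set (c Level.⊔ ℓ)
    FClosed T = Σ (ℕ → Carrier) (IsClosedEnumeration T)

    FClosed⇒IsSubalgebra : ∀ {T} → FClosed T → IsSubalgebra (mem T)
    FClosed⇒IsSubalgebra {T} (e , closed) = record
      { ⊤-closed = ⊤-mem
      ; ∧-closed = λ x∈ y∈ →
          let a , ea≈x = onto x∈ ; b , eb≈y = onto y∈
          in  mem-resp T (∧-cong ea≈x eb≈y) (∧-mem a b)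
      ; ∁-closed = λ x∈ → let a , ea≈x = onto x∈ in mem-resp T (¬-cong ea≈x) (∁-mem a)
      }
      where open IsClosedEnumeration closed

    module ChainUnion (ch : ℕ → CountableSubset A) (ch-closed : ∀ k → FClosed (ch k))
                      (ch-chain : ∀ k l → _⊆_ A (ch k) (ch l) ⊎ _⊆_ A (ch l) (ch k))
                      (U : CountableSubset A) (U⊆⋃ch : ∀ x → mem U x → ∃ λ k → mem (ch k) x)
                      (ch⊆U : ∀ k x → mem (ch k) x → mem U x) where
      open module Ch {k} = IsClosedEnumeration (proj₂ (ch-closed k))

      enum : ℕ → ℕ → Carrier
      enum k = proj₁ (ch-closed k)

      enumU : ℕ → Carrier
      enumU = uncurry enum ∘ unpair

      enumU-onto : ∀ k m → ∃ λ n → enumU n ≡ enum k m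
      enumU-onto k m = let n , eq = unpair-onto k m in n , ≡.cong (uncurry enum) eq

      ∧-memU : ∀ k₁ m₁ k₂ m₂ → mem U (enum k₁ m₁ ∧ enum k₂ m₂)
      ∧-memU k₁ m₁ k₂ m₂ with ch-chain k₁ k₂
      ... | inj₁ ch₁⊆ch₂ =
        let m , em≈ = onto (ch₁⊆ch₂ _ (into m₁))
        in  ch⊆U k₂ _ (mem-resp (ch k₂) (∧-congʳ em≈) (∧-mem m m₂))
      ... | inj₂ ch₂⊆ch₁ =
        let m , em≈ = onto (ch₂⊆ch₁ _ (into m₂))
        in  ch⊆U k₁ _ (mem-resp (ch k₁) (∧-congˡ em≈) (∧-mem m₁ m))

      closed : IsClosedEnumeration U enumU
      closed = record
        { onto  = λ x∈ →
            let k , x∈k = U⊆⋃ch _ x∈ ; m , em≈x = onto x∈k ; n , eq = enumU-onto k m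
            in  n , trans (reflexive eq) em≈x
        ; into  = λ n → ch⊆U _ _ (into _)
        ; ⊤-mem = ch⊆U 0 _ ⊤-mem
        ; ∧-mem = λ a b → ∧-memU _ _ _ _
        ; ∁-mem = λ a → ch⊆U _ _ (∁-mem _)
        ; f-mem = λ a z∈ → ch⊆U _ _ (f-mem _ z∈)
        }

    step : (ℕ → Carrier) → ℕ → ℕ → ℕ → Carrier
    step g 0                   a b = g a
    step g 1                   a b = g a ∧ g b
    step g 2                   a b = ∁ g a
    step g (suc (suc (suc _))) a b = nthOr (g a) (f (g a)) b

    closureStep : (ℕ → Carrier) → ℕ → Carrier
    closureStep g n = step g (proj₁ (unpair n)) (proj₁ (unpair (proj₂ (unpair n))))
                                                (proj₂ (unpair (proj₂ (unpair n))))

    closureStep-onto : ∀ g tag a b → ∃ λ n → closureStep g n ≡ step g tag a b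
    closureStep-onto g tag a b =
      let r , r≡ = unpair-onto a b ; n , n≡ = unpair-onto tag r
      in  n , ≡.cong₂ (λ p q → step g (proj₁ p) (proj₁ q) (proj₂ q)) n≡
                      (≡.trans (≡.cong (unpair ∘ proj₂) n≡) r≡)

    module Closure (g : ℕ → Carrier) where

      stage : ℕ → ℕ → Carrier
      stage zero    zero    = ⊤
      stage zero    (suc a) = g a
      stage (suc k) n       = closureStep (stage k) n

      stage-≤′ : ∀ {k l} → k ≤′ l → ∀ a → ∃ λ a′ → stage l a′ ≡ stage k a
      stage-≤′ ≤′-refl             a = a , ≡.refl
      stage-≤′ (≤′-step {l} k≤′l) a =
        let a′ , eq = stage-≤′ k≤′l a ; n , eq′ = closureStep-onto (stage l) 0 a′ 0
        in  n , ≡.trans eq′ eq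

      InStages : Carrier → Set ℓ
      InStages x = ∃₂ λ k a → stage k a ≈ x

      next-stage : ∀ k tag a b {x} → step (stage k) tag a b ≈ x → InStages x
      next-stage k tag a b eq =
        let n , n≡ = closureStep-onto (stage k) tag a b in suc k , n , trans (reflexive n≡) eq

      enum : ℕ → Carrier
      enum = uncurry stage ∘ unpair

      enum-into : ∀ n → InStages (enum n)
      enum-into n = proj₁ (unpair n) , proj₂ (unpair n) , refl

      enum-onto : ∀ {x} → InStages x → ∃ λ n → enum n ≈ x
      enum-onto (k , a , eq) =
        let n , n≡ = unpair-onto k a in n , trans (reflexive (≡.cong (uncurry stage) n≡)) eq

      ∧-InStages : ∀ k₁ a₁ k₂ a₂ → InStages (stage k₁ a₁ ∧ stage k₂ a₂)
      ∧-InStages k₁ a₁ k₂ a₂ =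
        let b₁ , eq₁ = stage-≤′ (≤⇒≤′ (m≤m⊔n k₁ k₂)) a₁
            b₂ , eq₂ = stage-≤′ (≤⇒≤′ (m≤n⊔m k₁ k₂)) a₂
        in  next-stage (k₁ ⊔ k₂) 1 b₁ b₂ (∧-cong (reflexive eq₁) (reflexive eq₂))

      closure : CountableSubset A
      closure = record
        { mem       = Lift c ∘ InStages
        ; mem-resp  = λ { x≈y (lift (k , a , eq)) → lift (k , a , trans eq x≈y) }
        ; countable = inj₂ (enum , lift ∘ enum-into , λ x → enum-onto ∘ lower)
        }

      closure-closed : IsClosedEnumeration closure enum
      closure-closed = record
        { onto  = enum-onto ∘ lower
        ; into  = lift ∘ enum-into
        ; ⊤-mem = lift (0 , 0 , refl)
        ; ∧-mem = λ a b → lift (∧-InStages (proj₁ (unpair a)) (proj₂ (unpair a))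
                                            (proj₁ (unpair b)) (proj₂ (unpair b)))
        ; ∁-mem = λ a → lift (next-stage (proj₁ (unpair a)) 2 (proj₂ (unpair a)) 0 refl)
        ; f-mem = λ a z∈ → let b , nth≈z = nthOr-complete (enum a) z∈
                           in  lift (next-stage (proj₁ (unpair a)) 3 (proj₂ (unpair a)) b nth≈z)
        }

      g-∈closure : ∀ k → mem closure (g k)
      g-∈closure k = lift (0 , suc k , refl)

    cofinal : ∀ S → Σ (CountableSubset A) λ T → FClosed T × _⊆_ A S T
    cofinal S with countable S
    ... | inj₁ empty = Closure.closure (const ⊤) , (_ , Closure.closure-closed _) ,
                       λ x x∈S → ⊥-elim (empty x x∈S)
    ... | inj₂ (g , _ , g-onto) = Closure.closure g , (_ , Closure.closure-closed g) ,
      λ x x∈S → let k , gk≈x = g-onto x x∈S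
                in  mem-resp (Closure.closure g) gk≈x (Closure.g-∈closure g k)

    FClosed-isClub : IsClub A FClosed
    FClosed-isClub = cofinal , λ ch ch-closed ch-chain U U⊆ ⊆U →
      _ , ChainUnion.closed ch ch-closed ch-chain U U⊆ ⊆U

    -- Relative completeness

    module _ {d : ℕ} (hyp : Hyp A d f) {n : ℕ} (n<d : n ℕ.< d)
             (T : Fin n → CountableSubset A) (T-closed : ∀ i → FClosed (T i)) where

      E : Fin n → Pred A
      E i = mem (T i)

      B : Pred A
      B = ⟨_⟩ A (⋃ E)

      interpolant : ∀ y (t : Fin n → Carrier) → (∀ i → E i (t i)) → ⋀ A n t ≤ y →
        Σ Carrier λ w → ⟨_⟩ A (ListSet A (f (∁ y))) w × B w × ⋀ A n t ≤ w × w ≤ y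
      interpolant y t t∈E t≤y =
        let z , z∈ , ⋀z≈⊥ , x≤z = hyp (suc n) n<d x ⋀x≈⊥
            t≤⋀z′ = ≤-respˡ (⋀-cong n rep≈t) (⋀-monotonic n (≤A⇒≤ ∘ x≤z ∘ Fin.suc))
        in  ∁ z Fin.zero
          , neg (proj₁ (z∈ Fin.zero))
          , neg (⟨⟩-monotone generator (proj₂ (z∈ Fin.zero)))
          , ≤-trans t≤⋀z′ (disjoint⇒≤∁ (trans (∧-comm _ _) ⋀z≈⊥))
          , ∁≤⇒∁≤ (≤A⇒≤ (x≤z Fin.zero))
        where
        rep : Fin n → ℕ
        rep i = proj₁ (IsClosedEnumeration.onto (proj₂ (T-closed i)) (t∈E i))
        rep≈t : ∀ i → proj₁ (T-closed i) (rep i) ≈ t i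
        rep≈t i = proj₂ (IsClosedEnumeration.onto (proj₂ (T-closed i)) (t∈E i))
        x : Fin (suc n) → Carrier
        x Fin.zero    = ∁ y
        x (Fin.suc i) = proj₁ (T-closed i) (rep i)
        ⋀x≈⊥ : ⋀ A (suc n) x ≈ ⊥
        ⋀x≈⊥ = trans (∧-congˡ (⋀-cong n rep≈t)) (trans (∧-comm _ _) (≤⇒disjoint-∁ t≤y))
        generator : ∀ {w} → (∃ λ j → j ≢ Fin.zero × ListSet A (f (x j)) w) → ⋃ E w
        generator (Fin.zero  , 0≢0 , _)   = ⊥-elim (0≢0 ≡.refl)
        generator (Fin.suc i , _   , w∈) =
          i , IsClosedEnumeration.f-mem (proj₂ (T-closed i)) (rep i) w∈

      module _ (lem : ∀ {p} → ExcludedMiddle p) (y : Carrier) where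

        pick : Carrier → Carrier
        pick z with lem {P = B z × z ≤ y}
        ... | yes _ = z
        ... | no  _ = ⊥

        pick-∈B : ∀ z → B (pick z)
        pick-∈B z with lem {P = B z × z ≤ y}
        ... | yes (z∈B , _) = z∈B
        ... | no  _         = bot

        pick-≤ : ∀ z → pick z ≤ y
        pick-≤ z with lem {P = B z × z ≤ y}
        ... | yes (_ , z≤y) = z≤y
        ... | no  _         = ⊥≤

        ≤-pick : ∀ {w z} → B w → w ≤ y → w ≈ z → w ≤ pick z
        ≤-pick {w} {z} w∈B w≤y w≈z with lem {P = B z × z ≤ y}
        ... | yes _   = ≤-respʳ w≈z (sym (∧-idem w))
        ... | no  ¬pz = ⊥-elim (¬pz (resp w≈z w∈B , ≤-respˡ w≈z w≤y))

        maximum : Carrier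
        maximum = ⋁ (map pick (elements (f (∁ y))))

        maximum-∈B : B maximum
        maximum-∈B = ⋁-map-closed B bot join pick (elements (f (∁ y))) pick-∈B

        maximum-≤ : maximum ≤ y
        maximum-≤ = ⋁-map-closed (_≤ y) ⊥≤ ∨-least pick (elements (f (∁ y))) pick-≤

        JoinOfMeets-≤maximum : ∀ {x} → JoinOfMeets E x → x ≤ y → x ≤ maximum
        JoinOfMeets-≤maximum (meets t t∈E) t≤y =
          let w , w∈⟨f∁y⟩ , w∈B , t≤w , w≤y = interpolant y t t∈E t≤y
          in  ⋁-map-upper pick _
                (Any.map (λ w≈z → ≤-trans t≤w (≤-pick w∈B w≤y w≈z))
                         (⟨⟩⊆elements _ w∈⟨f∁y⟩))
        JoinOfMeets-≤maximum ⊥-join       _   = ⊥≤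
        JoinOfMeets-≤maximum (∨-join p q) x≤y =
          ∨-least (JoinOfMeets-≤maximum p (≤-trans (x≤x∨y _ _) x≤y))
                  (JoinOfMeets-≤maximum q (≤-trans (y≤x∨y _ _) x≤y))
        JoinOfMeets-≤maximum (≈-join e p) x≤y =
          ≤-respˡ e (JoinOfMeets-≤maximum p (≤-respˡ (sym e) x≤y))

      relComplete : (∀ {p} → ExcludedMiddle p) → RelComplete A B
      relComplete lem y =
          maximum lem y
        , maximum-∈B lem y
        , ≤⇒≤A (maximum-≤ lem y)
        , λ x x∈B x≤y → ≤⇒≤A (JoinOfMeets-≤maximum lem y
            (proj₁ (normalForm E (FClosed⇒IsSubalgebra ∘ T-closed) x∈B)) (≤A⇒≤ x≤y))

theorem2p22 : (lem : ∀ {p} → ExcludedMiddle p) →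
    ∀ {c ℓ : Level} (d : ℕ) (A : BooleanAlgebra c ℓ)
      (f : BooleanAlgebra.Carrier A → List (BooleanAlgebra.Carrier A)) →
    Hyp A d f → HasFN A d
theorem2p22 lem d A f hyp =
    FClosed A f
  , FClosed-isClub A f
  , λ n n<d T T-closed → relComplete A f hyp n<d T T-closed lem
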